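{- Let $n\geq 4$ be an integer, $a=f_n^2$, $b=f_{n+1}^2$, $c=f_{n+2}^2$, let $\ell$ be the least non-negative integer with $\ell b\equiv c\pmod a$, $\overline{q}=\left\lfloor \frac{a}{\ell}\right\rfloor$, $\overline{r}=a-\overline{q}\ell$, and let $\overline{u}$ be the least non-negative integer with $\overline{u}\equiv \overline{r}\pmod{(\ell-\overline{r})}$. If $n\geq 8$ is even, then $\overline{u}=\overline{r}=f_nf_{n-6}-4$. If $n\geq 5$ is odd, then $\overline{u}=\overline{r}=f_nf_{n-3}-1$.
   Context: The Fibonacci numbers are defined by $f_0=0$, $f_1=1$, $f_k=f_{k-1}+f_{k-2}$ for $k\geq 2$. -}

module Defs where

open import Data.Nat using (ℕ; zero; suc; _+_; _≤_)
open import Data.Integer using (ℤ; +_; _-_)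
open import Data.Integer.Divisibility using (_∣_)

fib : ℕ → ℕ
fib zero = 0
fib (suc zero) = 1
fib (suc (suc k)) = fib (suc k) + fib k

_≡_[mod_] : ℕ → ℕ → ℕ → Set
x ≡ y [mod m ] = (+ m) ∣ ((+ x) - (+ y))

IsLeast : (ℕ → Set) → ℕ → Set
IsLeast P k = P k × (∀ j → P j → k ≤ j)
  where open import Data.Product using (_×_)

{-# OPTIONS --safe #-}

-- Write F = f_n and B = f_{n+1}, so that c = (B + F)^2. By Cassini, B f_{n-1} = F^2 ± 1, so B is
-- invertible modulo F^2 and the least ℓ is the unique solution below F^2. That solution is
-- ℓ = 1 + F m with m = f_{n-3} (n even) or m = 2 f_{n-2} (n odd): in both cases m B ≡ 2 (mod F),
-- hence (1 + F m) B^2 ≡ B^2 + 2 B F ≡ (B + F)^2 (mod F^2). Moreover F = q m + G with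
-- (q, G) = (4, f_{n-6}) resp. (1, f_{n-3}), which gives F^2 = (F G - q) + q ℓ with 2 (F G - q) < ℓ.
-- So r̄ = F G - q, and r̄ < ℓ - r̄ makes r̄ its own least residue. Every Fibonacci identity used is a
-- polynomial identity in x = f_i, y = f_{i+1} modulo Cassini's relation y^2 = x (x + y) + 1, i even.
module Submission where

open import Defs
open import Data.Nat using (ℕ; zero; suc; _+_; _*_; _∸_; _^_; _≤_; _<_; _/_; _%_; NonZero; z≤n; s≤s)
open import Data.Nat.Properties
open import Data.Nat.DivMod using (m%n≡m∸m/n*n; [m+kn]%n≡m%n; m<n⇒m%n≡m)
open import Data.Nat.Divisibility using (>⇒∤) renaming (_∣_ to _∣ℕ_)
open import Data.Nat.Tactic.RingSolver using (solve-∀)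
open import Data.Product using (_×_; _,_)
open import Data.Sum using (_⊎_; inj₁; inj₂)
open import Relation.Nullary using (contradiction)
open import Relation.Binary.PropositionalEquality
  using (_≡_; refl; sym; trans; cong; cong₂; subst; subst₂; module ≡-Reasoning)
import Data.Integer as ℤ
import Data.Integer.Properties as ℤP
import Data.Integer.Divisibility.Signed as ℤ∣
import Data.Integer.Tactic.RingSolver as ℤRing

module _ where
  -- opened only here: elsewhere `+_` would make sections such as `(a +_)` ambiguous
  open ℤ using (+_)

  ≡-mod-by-multiples : ∀ {m} x y s t → x + s * m ≡ y + t * m → x ≡ y [mod m ]
  ≡-mod-by-multiples {m} x y s t eq = ℤ∣.∣⇒∣ᵤ (ℤ∣.divides (+ t ℤ.- + s) (begin
      + x ℤ.- + y      ≡⟨ difference (+ x) (+ y) (+ s) (+ t) (+ m) ⟩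
      D ℤ.+ (X ℤ.- Y)  ≡⟨ cong (λ z → D ℤ.+ (z ℤ.- Y)) X≡Y ⟩
      D ℤ.+ (Y ℤ.- Y)  ≡⟨ cong (λ z → D ℤ.+ z) (ℤP.+-inverseʳ Y) ⟩
      D ℤ.+ ℤ.0ℤ       ≡⟨ ℤP.+-identityʳ D ⟩
      D                ∎))
    where
    open ≡-Reasoning
    D = (+ t ℤ.- + s) ℤ.* + m
    X = + x ℤ.+ + s ℤ.* + m
    Y = + y ℤ.+ + t ℤ.* + m
    cast : ∀ u v → + (u + v * m) ≡ + u ℤ.+ + v ℤ.* + m
    cast u v = trans (ℤP.pos-+ u (v * m)) (cong (λ z → + u ℤ.+ z) (ℤP.pos-* v m))
    X≡Y : X ≡ Y
    X≡Y = trans (sym (cast x s)) (trans (cong +_ eq) (cast y t))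
    difference : ∀ x y s t m →
      x ℤ.- y ≡ (t ℤ.- s) ℤ.* m ℤ.+ ((x ℤ.+ s ℤ.* m) ℤ.- (y ℤ.+ t ℤ.* m))
    difference = ℤRing.solve-∀

  ≡-mod-refl : ∀ {m} x → x ≡ x [mod m ]
  ≡-mod-refl x = ≡-mod-by-multiples x x 0 0 refl

  ≡-mod-cancel-unit : ∀ {m b w c} x y → (b * w) ≡ 1 [mod m ] →
    (x * b) ≡ c [mod m ] → (y * b) ≡ c [mod m ] → x ≡ y [mod m ]
  ≡-mod-cancel-unit {m} {b} {w} {c} x y bw≡1 xb≡c yb≡c =
    ℤ∣.∣⇒∣ᵤ (subst (+ m ℤ∣.∣_) (identity (+ x) (+ y) (+ b) (+ w) (+ c))
      (ℤ∣.∣m∣n⇒∣m-n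
        (ℤ∣.∣n⇒∣m*n (+ w) (ℤ∣.∣m∣n⇒∣m-n (signed x b c xb≡c) (signed y b c yb≡c)))
        (ℤ∣.∣n⇒∣m*n (+ x ℤ.- + y) (signed b w 1 bw≡1))))
    where
    signed : ∀ u v d → (u * v) ≡ d [mod m ] → + m ℤ∣.∣ + u ℤ.* + v ℤ.- + d
    signed u v d uv≡d = subst (λ z → + m ℤ∣.∣ z ℤ.- + d) (ℤP.pos-* u v) (ℤ∣.∣ᵤ⇒∣ uv≡d)
    identity : ∀ x y b w c →
      w ℤ.* ((x ℤ.* b ℤ.- c) ℤ.- (y ℤ.* b ℤ.- c)) ℤ.- (x ℤ.- y) ℤ.* (b ℤ.* w ℤ.- ℤ.1ℤ)
        ≡ x ℤ.- y
    identity = ℤRing.solve-∀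

  m∣n∧n<m⇒n≡0 : ∀ {m n} → m ∣ℕ n → n < m → n ≡ 0
  m∣n∧n<m⇒n≡0 {n = zero}  _   _   = refl
  m∣n∧n<m⇒n≡0 {n = suc _} m∣n n<m = contradiction m∣n (>⇒∤ n<m)

  ≡-mod-≤-<⇒≡ : ∀ {m x y} → x ≡ y [mod m ] → x ≤ y → y < m → x ≡ y
  ≡-mod-≤-<⇒≡ {m} {x} {y} x≡y x≤y y<m =
    ≤-antisym x≤y (m∸n≡0⇒m≤n (m∣n∧n<m⇒n≡0 m∣y∸x (≤-<-trans (m∸n≤m y x) y<m)))
    where
    open ≡-Reasoning
    distance : ℤ.∣ + x ℤ.- + y ∣ ≡ y ∸ x
    distance = begin
      ℤ.∣ + x ℤ.- + y ∣  ≡⟨ cong ℤ.∣_∣ (ℤP.m-n≡m⊖n x y) ⟩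
      ℤ.∣ x ℤ.⊖ y ∣      ≡⟨ ℤP.∣m⊖n∣≡∣n⊖m∣ x y ⟩
      ℤ.∣ y ℤ.⊖ x ∣      ≡⟨ cong ℤ.∣_∣ (ℤP.⊖-≥ x≤y) ⟩
      y ∸ x              ∎
    m∣y∸x : m ∣ℕ y ∸ x
    m∣y∸x = subst (m ∣ℕ_) distance x≡y

least-solution-unique : ∀ {a b c w L ℓ} → (b * w) ≡ 1 [mod a ] → (L * b) ≡ c [mod a ] → L < a →
  IsLeast (λ x → (x * b) ≡ c [mod a ]) ℓ → ℓ ≡ L
least-solution-unique {a} {b} {c} {w} {L} {ℓ} bw≡1 L-solves L<a (ℓ-solves , ℓ-least) =
  ≡-mod-≤-<⇒≡ (≡-mod-cancel-unit {a} {b} {w} {c} ℓ L bw≡1 ℓ-solves L-solves) (ℓ-least L L-solves) L<a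

least-representative : ∀ {d r u} → r < d → IsLeast (λ x → x ≡ r [mod d ]) u → u ≡ r
least-representative {r = r} r<d (u≡r , u-least) = ≡-mod-≤-<⇒≡ u≡r (u-least r (≡-mod-refl r)) r<d

remainder-unique : ∀ {a ℓ q r} .{{_ : NonZero ℓ}} → a ≡ r + q * ℓ → r < ℓ → a ∸ (a / ℓ) * ℓ ≡ r
remainder-unique {a} {ℓ} {q} {r} a≡r+qℓ r<ℓ = begin
  a ∸ (a / ℓ) * ℓ  ≡⟨ m%n≡m∸m/n*n a ℓ ⟨
  a % ℓ            ≡⟨ cong (_% ℓ) a≡r+qℓ ⟩
  (r + q * ℓ) % ℓ  ≡⟨ [m+kn]%n≡m%n r q ℓ ⟩
  r % ℓ            ≡⟨ m<n⇒m%n≡m r<ℓ ⟩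
  r                ∎
  where open ≡-Reasoning

least-residue-of-small-remainder : ∀ {a ℓ q r} .{{_ : NonZero ℓ}} → a ≡ r + q * ℓ → r + r < ℓ →
  let r̄ = a ∸ (a / ℓ) * ℓ in
  (ū : ℕ) → IsLeast (λ x → x ≡ r̄ [mod (ℓ ∸ r̄) ]) ū → (ū ≡ r̄) × (r̄ ≡ r)
least-residue-of-small-remainder {a} {ℓ} {q} {r} a≡r+qℓ r+r<ℓ ū ū-least =
  least-representative (subst (λ t → t < ℓ ∸ t) (sym r̄≡r) r<ℓ∸r) ū-least , r̄≡r
  where
  r̄≡r : a ∸ (a / ℓ) * ℓ ≡ r
  r̄≡r = remainder-unique {q = q} a≡r+qℓ (≤-<-trans (m≤m+n r r) r+r<ℓ)
  r<ℓ∸r : r < ℓ ∸ r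
  r<ℓ∸r = m+n≤o⇒m≤o∸n (suc r) r+r<ℓ

least-residue-of-least-solution : ∀ {a b c w L q r} →
  (b * w) ≡ 1 [mod a ] → (L * b) ≡ c [mod a ] → L < a → a ≡ r + q * L → r + r < L →
  (ℓ : ℕ) → IsLeast (λ x → (x * b) ≡ c [mod a ]) ℓ → .{{_ : NonZero ℓ}} →
  let r̄ = a ∸ (a / ℓ) * ℓ in
  (ū : ℕ) → IsLeast (λ x → x ≡ r̄ [mod (ℓ ∸ r̄) ]) ū → (ū ≡ r̄) × (r̄ ≡ r)
least-residue-of-least-solution {a} {b} {c} {w} {L} {q} bw≡1 L-solves L<a a≡r+qL r+r<L ℓ ℓ-least
  with refl ← least-solution-unique {a} {b} {c} {w} bw≡1 L-solves L<a ℓ-least =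
  least-residue-of-small-remainder {q = q} a≡r+qL r+r<L

module _ {F m G q : ℕ} (F≡q*m+G : F ≡ q * m + G) (0<G : 0 < G) (G+G≤m : G + G ≤ m) where

  q<F*G : q < F * G
  q<F*G = begin-strict
    q          ≡⟨ *-identityʳ q ⟨
    q * 1      ≤⟨ *-monoʳ-≤ q (≤-trans 0<G (≤-trans (m≤m+n G G) G+G≤m)) ⟩
    q * m      <⟨ m<m+n (q * m) 0<G ⟩
    q * m + G  ≡⟨ F≡q*m+G ⟨
    F          ≡⟨ *-identityʳ F ⟨
    F * 1      ≤⟨ *-monoʳ-≤ F 0<G ⟩
    F * G      ∎
    where open ≤-Reasoning

  F^2≡[F*G∸q]+q*[1+F*m] : F ^ 2 ≡ (F * G ∸ q) + q * (1 + F * m)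
  F^2≡[F*G∸q]+q*[1+F*m] = begin
    F * (F * 1)                    ≡⟨ cong (λ t → F * (t * 1)) F≡q*m+G ⟩
    F * ((q * m + G) * 1)          ≡⟨ expand F q m G ⟩
    q * (F * m) + F * G            ≡⟨ cong (q * (F * m) +_) (m∸n+n≡m (<⇒≤ q<F*G)) ⟨
    q * (F * m) + (F * G ∸ q + q)  ≡⟨ collect (F * G ∸ q) q (F * m) ⟩
    (F * G ∸ q) + q * (1 + F * m)  ∎
    where
    open ≡-Reasoning
    expand : ∀ F q m G → F * ((q * m + G) * 1) ≡ q * (F * m) + F * G
    expand = solve-∀
    collect : ∀ r q t → q * t + (r + q) ≡ r + q * (1 + t)
    collect = solve-∀

  1+F*m<F^2 : .{{_ : NonZero q}} → 1 + F * m < F ^ 2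
  1+F*m<F^2 = begin-strict
    1 + F * m                    <⟨ m<n+m (1 + F * m) (m<n⇒0<n∸m q<F*G) ⟩
    (F * G ∸ q) + (1 + F * m)    ≤⟨ +-monoʳ-≤ (F * G ∸ q) (m≤n*m (1 + F * m) q) ⟩
    (F * G ∸ q) + q * (1 + F * m) ≡⟨ F^2≡[F*G∸q]+q*[1+F*m] ⟨
    F ^ 2                        ∎
    where open ≤-Reasoning

[F*G∸q]+[F*G∸q]<1+F*m : ∀ {F m G} q → G + G ≤ m → (F * G ∸ q) + (F * G ∸ q) < 1 + F * m
[F*G∸q]+[F*G∸q]<1+F*m {F} {m} {G} q G+G≤m = s≤s (begin
  (F * G ∸ q) + (F * G ∸ q)  ≤⟨ +-mono-≤ (m∸n≤m (F * G) q) (m∸n≤m (F * G) q) ⟩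
  F * G + F * G              ≡⟨ *-distribˡ-+ F G G ⟨
  F * (G + G)                ≤⟨ *-monoʳ-≤ F G+G≤m ⟩
  F * m                      ∎)
  where open ≤-Reasoning

[1+F*m]*B^2≡[B+F]^2 : ∀ {F B m k} → m * B ≡ 2 + k * F → ((1 + F * m) * B ^ 2) ≡ (B + F) ^ 2 [mod F ^ 2 ]
[1+F*m]*B^2≡[B+F]^2 {F} {B} {m} {k} m*B≡2+k*F = ≡-mod-by-multiples _ _ 1 (B * k) (begin
  (1 + F * m) * (B * (B * 1)) + 1 * (F * (F * 1))  ≡⟨ expand F B m ⟩
  B * B + F * F + F * B * (m * B)                   ≡⟨ cong (λ t → B * B + F * F + F * B * t) m*B≡2+k*F ⟩
  B * B + F * F + F * B * (2 + k * F)               ≡⟨ collect F B k ⟩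
  (B + F) * ((B + F) * 1) + B * k * (F * (F * 1))   ∎)
  where
  open ≡-Reasoning
  expand : ∀ F B m → (1 + F * m) * (B * (B * 1)) + 1 * (F * (F * 1)) ≡ B * B + F * F + F * B * (m * B)
  expand = solve-∀
  collect : ∀ F B k → B * B + F * F + F * B * (2 + k * F) ≡ (B + F) * ((B + F) * 1) + B * k * (F * (F * 1))
  collect = solve-∀

x^2≡1 : ∀ {x M} → x ≡ 1 + M ⊎ x + 1 ≡ M → (x ^ 2) ≡ 1 [mod M ]
x^2≡1 {M = M} (inj₁ refl) = ≡-mod-by-multiples ((1 + M) ^ 2) 1 0 (2 + M) (square M)
  where
  square : ∀ M → (1 + M) * ((1 + M) * 1) + 0 * M ≡ 1 + (2 + M) * M
  square = solve-∀
x^2≡1 {x} (inj₂ refl) = ≡-mod-by-multiples (x ^ 2) 1 2 (x + 1) (square x)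
  where
  square : ∀ x → x * (x * 1) + 2 * (x + 1) ≡ 1 + (x + 1) * (x + 1)
  square = solve-∀

record ResidueCertificate (F B G q : ℕ) : Set where
  field
    m k P     : ℕ
    F≡q*m+G   : F ≡ q * m + G
    0<G       : 0 < G
    G+G≤m     : G + G ≤ m
    m*B≡2+k*F : m * B ≡ 2 + k * F
    B*P≡F^2±1 : B * P ≡ 1 + F ^ 2 ⊎ B * P + 1 ≡ F ^ 2

certified-least-residue : ∀ {F B G q} .{{_ : NonZero q}} → ResidueCertificate F B G q →
  (ℓ : ℕ) → IsLeast (λ x → (x * B ^ 2) ≡ (B + F) ^ 2 [mod F ^ 2 ]) ℓ → .{{_ : NonZero ℓ}} →
  let r̄ = F ^ 2 ∸ (F ^ 2 / ℓ) * ℓ in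
  (ū : ℕ) → IsLeast (λ x → x ≡ r̄ [mod (ℓ ∸ r̄) ]) ū → (ū ≡ r̄) × (r̄ ≡ F * G ∸ q)
certified-least-residue {F} {B} {G} {q} certificate =
  least-residue-of-least-solution {F ^ 2} {B ^ 2} {(B + F) ^ 2} {P ^ 2} {q = q}
    B^2*P^2≡1
    ([1+F*m]*B^2≡[B+F]^2 {F} {B} {m} {k} m*B≡2+k*F)
    (1+F*m<F^2 {F} {m} {G} {q} F≡q*m+G 0<G G+G≤m)
    (F^2≡[F*G∸q]+q*[1+F*m] {F} {m} {G} {q} F≡q*m+G 0<G G+G≤m)
    ([F*G∸q]+[F*G∸q]<1+F*m {F} q G+G≤m)
  where
  open ResidueCertificate certificate
  square-product : ∀ B P → (B * P) * ((B * P) * 1) ≡ B * (B * 1) * (P * (P * 1))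
  square-product = solve-∀
  B^2*P^2≡1 : (B ^ 2 * P ^ 2) ≡ 1 [mod F ^ 2 ]
  B^2*P^2≡1 = subst (λ z → z ≡ 1 [mod F ^ 2 ]) (square-product B P) (x^2≡1 {B * P} {F ^ 2} B*P≡F^2±1)

fib-addition : ∀ j i → fib (suc j + i) ≡ fib j * fib i + fib (suc j) * fib (suc i)
fib-addition zero          i = sym (+-identityʳ (fib (suc i)))
fib-addition (suc zero)    i = base (fib i) (fib (suc i))
  where
  base : ∀ x y → y + x ≡ 1 * x + 1 * y
  base = solve-∀
fib-addition (suc (suc j)) i = trans (cong₂ _+_ (fib-addition (suc j) i) (fib-addition j i))
                                     (step (fib j) (fib (suc j)) (fib (suc (suc j))) (fib i) (fib (suc i)))
  where
  step : ∀ a b c x y → (b * x + c * y) + (a * x + b * y) ≡ (b + a) * x + (c + b) * y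
  step = solve-∀

fib-≤-suc : ∀ i → fib i ≤ fib (suc i)
fib-≤-suc zero    = z≤n
fib-≤-suc (suc i) = m≤m+n (fib (suc i)) (fib i)

fib-pos : ∀ {i} → 0 < i → 0 < fib i
fib-pos {suc zero}    _ = s≤s z≤n
fib-pos {suc (suc i)} _ = ≤-trans (fib-pos {suc i} (s≤s z≤n)) (m≤m+n (fib (suc i)) (fib i))

cassini : ∀ i → i % 2 ≡ 0 → fib (suc i) * fib (suc i) ≡ fib i * fib (2 + i) + 1
cassini zero          _      = refl
cassini (suc (suc i)) i-even = +-cancelʳ-≡ b _ _ (begin
  fib (3 + i) * fib (3 + i) + b          ≡⟨ period (fib i) (fib (suc i)) ⟩
  a + fib (1 + i) * fib (1 + i)          ≡⟨ cong (a +_) (cassini i i-even) ⟩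
  a + (b + 1)                            ≡⟨ swap a b ⟩
  a + 1 + b                              ∎)
  where
  open ≡-Reasoning
  a = fib (2 + i) * fib (4 + i)
  b = fib i * fib (2 + i)
  period : ∀ x y → ((y + x) + y) * ((y + x) + y) + x * (y + x)
                 ≡ (y + x) * (((y + x) + y) + (y + x)) + y * y
  period = solve-∀
  swap : ∀ a b → a + (b + 1) ≡ a + 1 + b
  swap = solve-∀

module _ {x y : ℕ} (cassini-xy : y * y ≡ x * (y + x) + 1) (0<x : 0 < x) (x≤y : x ≤ y) where

  private
    modulo-cassini : ∀ {a b} c → a + c * (x * (y + x) + 1) ≡ b + c * (y * y) → a ≡ b
    modulo-cassini {a} {b} c eq =
      +-cancelʳ-≡ (c * (x * (y + x) + 1)) a b (trans eq (cong (λ t → b + c * t) cassini-xy))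

  -- x = f_{n-6}, y = f_{n-5}: the fields are F = f_n, B = f_{n+1}, m = f_{n-3}, k = f_{n-2}, P = f_{n-1}
  even-certificate : ResidueCertificate (5 * x + 8 * y) (8 * x + 13 * y) x 4
  even-certificate = record
    { m = x + (y + y) ; k = 2 * x + 3 * y ; P = 3 * x + 5 * y
    ; F≡q*m+G   = split x y
    ; 0<G       = 0<x
    ; G+G≤m     = +-monoʳ-≤ x (≤-trans x≤y (m≤m+n y y))
    ; m*B≡2+k*F = modulo-cassini 2 (m*B x y)
    ; B*P≡F^2±1 = inj₁ (modulo-cassini 1 (B*P x y))
    }
    where
    split : ∀ x y → 5 * x + 8 * y ≡ 4 * (x + (y + y)) + x
    split = solve-∀
    m*B : ∀ x y → (x + (y + y)) * (8 * x + 13 * y) + 2 * (x * (y + x) + 1)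
                ≡ 2 + (2 * x + 3 * y) * (5 * x + 8 * y) + 2 * (y * y)
    m*B = solve-∀
    B*P : ∀ x y → (8 * x + 13 * y) * (3 * x + 5 * y) + 1 * (x * (y + x) + 1)
                ≡ 1 + (5 * x + 8 * y) * ((5 * x + 8 * y) * 1) + 1 * (y * y)
    B*P = solve-∀

  -- x = f_{n-3}, y = f_{n-2}: the fields are F = f_n, B = f_{n+1}, m = 2 f_{n-2}, k = 2 f_{n-1}, P = f_{n-1}
  odd-certificate : ResidueCertificate (1 * x + 2 * y) (2 * x + 3 * y) x 1
  odd-certificate = record
    { m = y + y ; k = 2 * (x + y) ; P = x + y
    ; F≡q*m+G   = split x y
    ; 0<G       = 0<x
    ; G+G≤m     = +-mono-≤ x≤y x≤y
    ; m*B≡2+k*F = modulo-cassini 2 (m*B x y)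
    ; B*P≡F^2±1 = inj₂ (sym (modulo-cassini 1 (F^2 x y)))
    }
    where
    split : ∀ x y → 1 * x + 2 * y ≡ 1 * (y + y) + x
    split = solve-∀
    m*B : ∀ x y → (y + y) * (2 * x + 3 * y) + 2 * (x * (y + x) + 1)
                ≡ 2 + 2 * (x + y) * (1 * x + 2 * y) + 2 * (y * y)
    m*B = solve-∀
    F^2 : ∀ x y → (1 * x + 2 * y) * ((1 * x + 2 * y) * 1) + 1 * (x * (y + x) + 1)
                ≡ (2 * x + 3 * y) * (x + y) + 1 + 1 * (y * y)
    F^2 = solve-∀

fib-even-certificate : ∀ n → 8 ≤ n → n % 2 ≡ 0 → ResidueCertificate (fib n) (fib (suc n)) (fib (n ∸ 6)) 4
fib-even-certificate n 8≤n n-even =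
  subst (λ n → ResidueCertificate (fib n) (fib (suc n)) (fib (n ∸ 6)) 4) 6+i≡n
    (subst₂ (λ F B → ResidueCertificate F B (fib i) 4) (sym (fib-addition 5 i)) (sym (fib-addition 6 i))
      (even-certificate (cassini i i-even) (fib-pos 0<i) (fib-≤-suc i)))
  where
  i = n ∸ 6
  6+i≡n : 6 + i ≡ n
  6+i≡n = m+[n∸m]≡n (≤-trans (m≤m+n 6 2) 8≤n)
  i-even : i % 2 ≡ 0
  i-even = subst (λ n → n % 2 ≡ 0) (sym 6+i≡n) n-even
  0<i : 0 < i
  0<i = ∸-monoˡ-≤ 6 (≤-trans (n≤1+n 7) 8≤n)

[1+i]%2≡1⇒i%2≡0 : ∀ i → suc i % 2 ≡ 1 → i % 2 ≡ 0
[1+i]%2≡1⇒i%2≡0 zero          _   = refl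
[1+i]%2≡1⇒i%2≡0 (suc zero)    ()
[1+i]%2≡1⇒i%2≡0 (suc (suc i)) odd = [1+i]%2≡1⇒i%2≡0 i odd

fib-odd-certificate : ∀ n → 5 ≤ n → n % 2 ≡ 1 → ResidueCertificate (fib n) (fib (suc n)) (fib (n ∸ 3)) 1
fib-odd-certificate n 5≤n n-odd =
  subst (λ n → ResidueCertificate (fib n) (fib (suc n)) (fib (n ∸ 3)) 1) 3+i≡n
    (subst₂ (λ F B → ResidueCertificate F B (fib i) 1) (sym (fib-addition 2 i)) (sym (fib-addition 3 i))
      (odd-certificate (cassini i i-even) (fib-pos 0<i) (fib-≤-suc i)))
  where
  i = n ∸ 3
  3+i≡n : 3 + i ≡ n
  3+i≡n = m+[n∸m]≡n (≤-trans (m≤m+n 3 2) 5≤n)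
  i-even : i % 2 ≡ 0
  i-even = [1+i]%2≡1⇒i%2≡0 i (subst (λ n → n % 2 ≡ 1) (sym 3+i≡n) n-odd)
  0<i : 0 < i
  0<i = ∸-monoˡ-≤ 3 (≤-trans (m≤m+n 4 1) 5≤n)

lemma4p22 : (n : ℕ) → 4 ≤ n →
    let a = fib n ^ 2
        b = fib (n + 1) ^ 2
        c = fib (n + 2) ^ 2
    in (ℓ : ℕ) → IsLeast (λ x → (x * b) ≡ c [mod a ]) ℓ → .{{_ : NonZero ℓ}} →
    let q̄ = a / ℓ
        r̄ = a ∸ q̄ * ℓ
    in (ū : ℕ) → IsLeast (λ x → x ≡ r̄ [mod (ℓ ∸ r̄) ]) ū →
    (8 ≤ n → n % 2 ≡ 0 → (ū ≡ r̄) × (r̄ ≡ fib n * fib (n ∸ 6) ∸ 4)) ×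
    (5 ≤ n → n % 2 ≡ 1 → (ū ≡ r̄) × (r̄ ≡ fib n * fib (n ∸ 3) ∸ 1))
-- after the rewrite, fib (n + 2) unfolds to fib (n + 1) + fib n
lemma4p22 n _ rewrite +-comm n 1 | +-comm n 2 = λ ℓ ℓ-least ū ū-least →
    (λ 8≤n n-even → certified-least-residue (fib-even-certificate n 8≤n n-even) ℓ ℓ-least ū ū-least)
  , (λ 5≤n n-odd → certified-least-residue (fib-odd-certificate n 5≤n n-odd) ℓ ℓ-least ū ū-least)
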